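{- Let $\mathcal{H}$ be a hypothesis class of $k$-wise partitions $h:\mathbf{I}\to[k]$. Then $$\Psi_B(\mathrm{rc}(\mathcal{H})) \in O\big(k\,\Psi_B(\mathcal{H})\log(k\,\Psi_B(\mathcal{H}))\big).$$
   Context: For $h:\mathbf{I}\to[k]$ and $\varphi:[k]\to[k]$ (not necessarily bijective), $\varphi\circ h$ is a rotation of $h$. The rotational completion of $\mathcal{H}$ is $\mathrm{rc}(\mathcal{H})=\{\varphi\circ h : h\in\mathcal{H},\ \varphi:[k]\to[k]\}$. A class $\mathcal{G}$ of functions $\mathbf{I}\to[k]$ $\Psi_B$-shatters points $x_1,\dots,x_n\in\mathbf{I}$ if there exist functions $\psi_1,\dots,\psi_n:[k]\to\{0,1\}$ such that for every $y\in\{0,1\}^n$ there is $g\in\mathcal{G}$ with $\psi_i(g(x_i))=y_i$ for all $i$. The $\Psi_B$-dimension $\Psi_B(\mathcal{G})$ is the largest $n$ such that some $n$ points are $\Psi_B$-shattered by $\mathcal{G}$. -}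

module Defs where

open import Data.Nat using (ℕ; _≤_)
open import Data.Fin using (Fin)
open import Data.Bool using (Bool)
open import Data.Product using (Σ; ∃; _×_)
open import Function.Definitions using (Injective)
open import Relation.Binary.PropositionalEquality using (_≡_)

-- [k] is Fin k; {0,1} is Bool; the domain 𝐈 is an arbitrary type.
-- A hypothesis class (a set of functions 𝐈 → [k]) is a predicate.
Class : Set → ℕ → Set₁
Class I k = (I → Fin k) → Set

-- Rotational completion: rc(H) = { φ ∘ h : h ∈ H, φ : [k] → [k] }
-- (φ ∘ h = g stated pointwise, to avoid function extensionality).
rc : {I : Set} {k : ℕ} → Class I k → Class I k
rc {I} {k} H g = Σ (I → Fin k) λ h → H h × Σ (Fin k → Fin k) λ φ → (∀ x → g x ≡ φ (h x))

PsiBShatters : {I : Set} {k : ℕ} → Class I k → (n : ℕ) → (Fin n → I) → Set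
PsiBShatters {I} {k} G n xs =
  Injective _≡_ _≡_ xs ×
  Σ (Fin n → Fin k → Bool) λ ψ →
    (y : Fin n → Bool) → Σ (I → Fin k) λ g → G g × (∀ i → ψ i (g (xs i)) ≡ y i)

IsPsiBDim : {I : Set} {k : ℕ} → Class I k → ℕ → Set
IsPsiBDim {I} G d =
  (Σ (Fin d → I) λ xs → PsiBShatters G d xs) ×
  (∀ n (xs : Fin n → I) → PsiBShatters G n xs → n ≤ d)

-- Fix, for every labelling v of the n shattered points, a hypothesis h ∈ H and a
-- rotation φ with v = ψ ∘ φ ∘ h, and colour v by φ: there are at most k ^ k colours.
-- The labellings of one colour share φ, so a set of points they shatter (in the VC
-- sense) is Ψ_B-shattered by H itself, using the maps ψᵢ ∘ φ; hence it has at most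
-- d points, and the Sauer–Shelah lemma bounds each colour class by (1 + n) ^ d.
-- Thus 2 ^ n ≤ k ^ k * (1 + n) ^ d, and elementary estimates give n ≤ 9 k d ⌈log₂ (k d)⌉.
module Submission where

open import Defs
open import Data.Nat using (ℕ; _≤_; _*_)
open import Data.Nat.Logarithm using (⌈log₂_⌉)
open import Data.Fin using (Fin)
open import Data.Product using (Σ)

open import Data.Bool using (Bool; true; false; T; _∨_; _∧_; not)
open import Data.Bool.Properties using (not-¬)
open import Data.Empty using (⊥; ⊥-elim)
open import Data.Fin using (zero; suc; toℕ; funToFin; finToFun)
open import Data.Fin.Properties using (toℕ-injective; toℕ<n; finToFun-funToFin)
  renaming (suc-injective to Fin-suc-injective)
open import Data.Nat using (zero; suc; _+_; _∸_; _^_; _<_; _≡ᵇ_; _<ᵇ_; z≤n; s≤s; s≤s⁻¹; >-nonZero; ⌈_/2⌉; ⌊_/2⌋)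
open import Data.Nat.Induction using (<-rec)
open import Data.Nat.Logarithm using (⌈log₂⌉-mono-≤; ⌈log₂⌈n/2⌉⌉≡⌈log₂n⌉∸1; ⌈log₂2^n⌉≡n)
open import Data.Nat.Properties
open import Algebra.Properties.CommutativeSemigroup +-commutativeSemigroup
  using () renaming (interchange to +-interchange)
open import Algebra.Properties.CommutativeSemigroup *-commutativeSemigroup
  using () renaming (interchange to *-interchange)
open import Data.Nat.Tactic.RingSolver using (solve-∀)
open import Data.Product using (_,_; proj₁; proj₂; _×_; ∃)
open import Data.Vec using (Vec; []; _∷_; lookup; replicate)
open import Function using (_∘_)
open import Relation.Binary.PropositionalEquality
open import Relation.Nullary using (yes; no)

-- Counting subsets of the Boolean cube

∑ : ∀ {n} → (Vec Bool n → ℕ) → ℕ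
∑ {zero}  f = f []
∑ {suc n} f = ∑ (f ∘ (false ∷_)) + ∑ (f ∘ (true ∷_))

∑-cong : ∀ {n} {f g : Vec Bool n → ℕ} → (∀ v → f v ≡ g v) → ∑ f ≡ ∑ g
∑-cong {zero}  f≗g = f≗g []
∑-cong {suc n} f≗g = cong₂ _+_ (∑-cong (f≗g ∘ (false ∷_))) (∑-cong (f≗g ∘ (true ∷_)))

∑-mono-≤ : ∀ {n} {f g : Vec Bool n → ℕ} → (∀ v → f v ≤ g v) → ∑ f ≤ ∑ g
∑-mono-≤ {zero}  f≤g = f≤g []
∑-mono-≤ {suc n} f≤g = +-mono-≤ (∑-mono-≤ (f≤g ∘ (false ∷_))) (∑-mono-≤ (f≤g ∘ (true ∷_)))

∑-distrib-+ : ∀ {n} (f g : Vec Bool n → ℕ) → ∑ (λ v → f v + g v) ≡ ∑ f + ∑ g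
∑-distrib-+ {zero}  f g = refl
∑-distrib-+ {suc n} f g =
  trans (cong₂ _+_ (∑-distrib-+ (f ∘ (false ∷_)) (g ∘ (false ∷_)))
                    (∑-distrib-+ (f ∘ (true ∷_)) (g ∘ (true ∷_))))
        (+-interchange (∑ (f ∘ (false ∷_))) (∑ (g ∘ (false ∷_)))
                       (∑ (f ∘ (true ∷_))) (∑ (g ∘ (true ∷_))))

∑-zero : ∀ n → ∑ {n} (λ _ → 0) ≡ 0
∑-zero zero    = refl
∑-zero (suc n) = cong₂ _+_ (∑-zero n) (∑-zero n)

∑-one : ∀ n → ∑ {n} (λ _ → 1) ≡ 2 ^ n
∑-one zero    = refl
∑-one (suc n) = cong₂ _+_ (∑-one n) (trans (∑-one n) (sym (+-identityʳ (2 ^ n))))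

𝟙 : Bool → ℕ
𝟙 true  = 1
𝟙 false = 0

∣_∣ : ∀ {n} → (Vec Bool n → Bool) → ℕ
∣ F ∣ = ∑ (𝟙 ∘ F)

𝟙-∨-∧ : ∀ a b → 𝟙 a + 𝟙 b ≡ 𝟙 (a ∨ b) + 𝟙 (a ∧ b)
𝟙-∨-∧ true  true  = refl
𝟙-∨-∧ true  false = refl
𝟙-∨-∧ false true  = refl
𝟙-∨-∧ false false = refl

∣∣-∨-∧ : ∀ {n} (F G : Vec Bool n → Bool) →
         ∣ F ∣ + ∣ G ∣ ≡ ∣ (λ v → F v ∨ G v) ∣ + ∣ (λ v → F v ∧ G v) ∣
∣∣-∨-∧ F G = begin
  ∣ F ∣ + ∣ G ∣                                     ≡⟨ ∑-distrib-+ (𝟙 ∘ F) (𝟙 ∘ G) ⟨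
  ∑ (λ v → 𝟙 (F v) + 𝟙 (G v))                     ≡⟨ ∑-cong (λ v → 𝟙-∨-∧ (F v) (G v)) ⟩
  ∑ (λ v → 𝟙 (F v ∨ G v) + 𝟙 (F v ∧ G v))         ≡⟨ ∑-distrib-+ (λ v → 𝟙 (F v ∨ G v)) (λ v → 𝟙 (F v ∧ G v)) ⟩
  ∣ (λ v → F v ∨ G v) ∣ + ∣ (λ v → F v ∧ G v) ∣   ∎
  where open ≡-Reasoning

-- The Sauer–Shelah lemma

-- A subset of the coordinates [n] is a mask M; select M enumerates it increasingly.
size : ∀ {n} → Vec Bool n → ℕ
size []          = 0
size (true  ∷ M) = suc (size M)
size (false ∷ M) = size M

select : ∀ {n} (M : Vec Bool n) → Fin (size M) → Fin n
select (true  ∷ M) zero    = zero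
select (true  ∷ M) (suc j) = suc (select M j)
select (false ∷ M) j       = suc (select M j)

select-injective : ∀ {n} (M : Vec Bool n) {i j} → select M i ≡ select M j → i ≡ j
select-injective (true  ∷ M) {zero}  {zero}  _  = refl
select-injective (true  ∷ M) {suc i} {suc j} eq = cong suc (select-injective M (Fin-suc-injective eq))
select-injective (false ∷ M)                 eq = select-injective M (Fin-suc-injective eq)

select-replicate-false : ∀ n → Fin (size (replicate n false)) → ⊥
select-replicate-false (suc n) = select-replicate-false n

Shatters : ∀ {n} → (Vec Bool n → Bool) → Vec Bool n → Set
Shatters F M = (f : Fin (size M) → Bool) →
  ∃ λ v → T (F v) × (∀ j → lookup v (select M j) ≡ f j)

nonempty⇒shatters-∅ : ∀ {n} (F : Vec Bool n → Bool) {v} → T (F v) → Shatters F (replicate n false)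
nonempty⇒shatters-∅ {n} F {v} Fv f = v , Fv , ⊥-elim ∘ select-replicate-false n

shatters-∨ : ∀ {n} (F : Vec Bool (suc n) → Bool) {M} →
  Shatters (λ v → F (false ∷ v) ∨ F (true ∷ v)) M → Shatters F (false ∷ M)
shatters-∨ F S f with S f
... | v , Fv , agrees with F (false ∷ v) in eq
...   | true  = false ∷ v , subst T (sym eq) _ , agrees
...   | false = true ∷ v , Fv , agrees

shatters-∧ : ∀ {n} (F : Vec Bool (suc n) → Bool) {M} →
  Shatters (λ v → F (false ∷ v) ∧ F (true ∷ v)) M → Shatters F (true ∷ M)
shatters-∧ F S f with S (f ∘ suc)
... | v , Fv , agrees = f zero ∷ v , both (f zero) , λ { zero → refl ; (suc j) → agrees j }
  where
  both : ∀ b → T (F (b ∷ v))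
  both false with F (false ∷ v)
  ... | true = _
  both true with F (false ∷ v) | F (true ∷ v)
  ... | true | true = _

-- Φ n e = ∑_{i < e} (n choose i)
Φ : ℕ → ℕ → ℕ
Φ n       zero    = 0
Φ zero    (suc e) = 1
Φ (suc n) (suc e) = Φ n (suc e) + Φ n e

sauer-shelah : ∀ {n} e (F : Vec Bool n → Bool) →
  (∀ M → Shatters F M → size M < e) → ∣ F ∣ ≤ Φ n e
sauer-shelah {n} zero F small = begin
  ∣ F ∣                 ≤⟨ ∑-mono-≤ empty ⟩
  ∑ {n} (λ _ → 0)       ≡⟨ ∑-zero n ⟩
  0                     ∎
  where
  open ≤-Reasoning
  empty : ∀ v → 𝟙 (F v) ≤ 0
  empty v with F v in eq
  ... | false = z≤n
  ... | true  = ⊥-elim (n≮0 (small _ (nonempty⇒shatters-∅ F (subst T (sym eq) _))))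
sauer-shelah {zero}  (suc e) F small with F []
... | true  = ≤-refl
... | false = z≤n
sauer-shelah {suc n} (suc e) F small = begin
  ∣ F₀ ∣ + ∣ F₁ ∣                                 ≡⟨ ∣∣-∨-∧ F₀ F₁ ⟩
  ∣ (λ v → F₀ v ∨ F₁ v) ∣ + ∣ (λ v → F₀ v ∧ F₁ v) ∣
    ≤⟨ +-mono-≤ (sauer-shelah (suc e) _ (λ M → small (false ∷ M) ∘ shatters-∨ F))
                (sauer-shelah e _ (λ M → s≤s⁻¹ ∘ small (true ∷ M) ∘ shatters-∧ F)) ⟩
  Φ n (suc e) + Φ n e                              ∎
  where
  open ≤-Reasoning
  F₀ F₁ : Vec Bool n → Bool
  F₀ = F ∘ (false ∷_)
  F₁ = F ∘ (true ∷_)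

Φ≤[1+n]^d : ∀ n d → Φ n (suc d) ≤ suc n ^ d
Φ≤[1+n]^d zero    d       = ≤-reflexive (sym (^-zeroˡ d))
Φ≤[1+n]^d (suc n) zero    = ≤-trans (≤-reflexive (+-identityʳ (Φ n 1))) (Φ≤[1+n]^d n zero)
Φ≤[1+n]^d (suc n) (suc d) = begin
  Φ n (suc (suc d)) + Φ n (suc d)   ≤⟨ +-mono-≤ (Φ≤[1+n]^d n (suc d)) (Φ≤[1+n]^d n d) ⟩
  suc n * suc n ^ d + suc n ^ d     ≡⟨ +-comm (suc n * suc n ^ d) (suc n ^ d) ⟩
  suc (suc n) * suc n ^ d           ≤⟨ *-monoʳ-≤ (suc (suc n)) (^-monoˡ-≤ d (n≤1+n (suc n))) ⟩
  suc (suc n) ^ suc d               ∎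
  where open ≤-Reasoning

-- Counting by colour classes

𝟙-<ᵇ-suc : ∀ c K → 𝟙 (c <ᵇ suc K) ≡ 𝟙 (c <ᵇ K) + 𝟙 (c ≡ᵇ K)
𝟙-<ᵇ-suc zero    zero    = refl
𝟙-<ᵇ-suc zero    (suc K) = refl
𝟙-<ᵇ-suc (suc c) zero    = refl
𝟙-<ᵇ-suc (suc c) (suc K) = 𝟙-<ᵇ-suc c K

𝟙-T : ∀ {b} → T b → 𝟙 b ≡ 1
𝟙-T {true} _ = refl

∣colour<K∣≤K*X : ∀ {n X} (colour : Vec Bool n → ℕ) K →
  (∀ c → ∣ (λ v → colour v ≡ᵇ c) ∣ ≤ X) → ∣ (λ v → colour v <ᵇ K) ∣ ≤ K * X
∣colour<K∣≤K*X {n}     colour zero    _     = ≤-reflexive (∑-zero n)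
∣colour<K∣≤K*X {n} {X} colour (suc K) small = begin
  ∣ (λ v → colour v <ᵇ suc K) ∣                            ≡⟨ ∑-cong (λ v → 𝟙-<ᵇ-suc (colour v) K) ⟩
  ∑ (λ v → 𝟙 (colour v <ᵇ K) + 𝟙 (colour v ≡ᵇ K))          ≡⟨ ∑-distrib-+ (λ v → 𝟙 (colour v <ᵇ K)) (λ v → 𝟙 (colour v ≡ᵇ K)) ⟩
  ∣ (λ v → colour v <ᵇ K) ∣ + ∣ (λ v → colour v ≡ᵇ K) ∣    ≤⟨ +-mono-≤ (∣colour<K∣≤K*X colour K small) (small K) ⟩
  K * X + X                                                ≡⟨ +-comm (K * X) X ⟩
  suc K * X                                                ∎
  where open ≤-Reasoning

pigeonhole : ∀ {n X} K (colour : Vec Bool n → ℕ) → (∀ v → colour v < K) →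
  (∀ c → ∣ (λ v → colour v ≡ᵇ c) ∣ ≤ X) → 2 ^ n ≤ K * X
pigeonhole {n} {X} K colour colour<K small = begin
  2 ^ n                       ≡⟨ ∑-one n ⟨
  ∑ {n} (λ _ → 1)             ≡⟨ ∑-cong (λ v → 𝟙-T (<⇒<ᵇ (colour<K v))) ⟨
  ∣ (λ v → colour v <ᵇ K) ∣   ≤⟨ ∣colour<K∣≤K*X colour K small ⟩
  K * X                       ∎
  where open ≤-Reasoning

-- Shattering by the rotational completion

shattering-needs-two-labels : ∀ {I k} {G : Class I k} {n} {xs : Fin (suc n) → I} →
  PsiBShatters G (suc n) xs → 2 ≤ k
shattering-needs-two-labels {k = zero} {xs = xs} (_ , _ , realise)
  with proj₁ (realise (λ _ → true)) (xs zero)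
... | ()
shattering-needs-two-labels {k = suc zero} {xs = xs} (_ , ψ , realise)
  with realise (λ i → not (ψ i zero))
... | g , _ , labels with g (xs zero) | labels zero
...   | zero | ψg≡not-ψg = ⊥-elim (not-¬ refl ψg≡not-ψg)
shattering-needs-two-labels {k = suc (suc k)} _ = s≤s (s≤s z≤n)

module RotationalCompletion {I : Set} {k : ℕ} {H : Class I k} {n : ℕ} {xs : Fin n → I}
                            (shattered : PsiBShatters (rc H) n xs) where

  ψ : Fin n → Fin k → Bool
  ψ = proj₁ (proj₂ shattered)

  record RotatedRealisation (v : Vec Bool n) : Set where
    field
      base     : I → Fin k
      base∈H   : H base
      rotation : Fin k → Fin k
      labels   : ∀ i → ψ i (rotation (base (xs i))) ≡ lookup v i

  realisation : ∀ v → RotatedRealisation v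
  realisation v with proj₂ (proj₂ shattered) (lookup v)
  ... | g , (h , h∈H , φ , g≗φ∘h) , g-labels = record
    { base     = h
    ; base∈H   = h∈H
    ; rotation = φ
    ; labels   = λ i → trans (cong (ψ i) (sym (g≗φ∘h (xs i)))) (g-labels i)
    }

  module Realisation (v : Vec Bool n) = RotatedRealisation (realisation v)
  open Realisation

  code : Vec Bool n → ℕ
  code v = toℕ (funToFin (rotation v))

  same-code⇒same-rotation : ∀ {v w} → code v ≡ code w → ∀ a → rotation v a ≡ rotation w a
  same-code⇒same-rotation {v} {w} eq a = begin
    rotation v a                          ≡⟨ finToFun-funToFin (rotation v) a ⟨
    finToFun (funToFin (rotation v)) a    ≡⟨ cong (λ c → finToFun c a) (toℕ-injective eq) ⟩
    finToFun (funToFin (rotation w)) a    ≡⟨ finToFun-funToFin (rotation w) a ⟩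
    rotation w a                          ∎
    where open ≡-Reasoning

  colour-class-shattering⇒Ψ_B-shattering : ∀ c M → Shatters (λ v → code v ≡ᵇ c) M →
    PsiBShatters H (size M) (xs ∘ select M)
  colour-class-shattering⇒Ψ_B-shattering c M S =
    select-injective M ∘ proj₁ shattered , ψ′ , realise
    where
    -- Any member of the (shattering, hence nonempty) class fixes the common rotation.
    v₀ : Vec Bool n
    v₀ = proj₁ (S (λ _ → false))

    ψ′ : Fin (size M) → Fin k → Bool
    ψ′ j = ψ (select M j) ∘ rotation v₀

    same-rotation : ∀ {v} → T (code v ≡ᵇ c) → ∀ a → rotation v₀ a ≡ rotation v a
    same-rotation {v} v∈c = same-code⇒same-rotation {v₀} {v}
      (trans (≡ᵇ⇒≡ (code v₀) c (proj₁ (proj₂ (S (λ _ → false))))) (sym (≡ᵇ⇒≡ (code v) c v∈c)))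

    realise : (f : Fin (size M) → Bool) →
      Σ (I → Fin k) λ g → H g × (∀ j → ψ′ j (g (xs (select M j))) ≡ f j)
    realise f with S f
    ... | v , v∈c , v-agrees = base v , base∈H v , λ j →
      trans (cong (ψ (select M j)) (same-rotation {v} v∈c (base v (xs (select M j)))))
            (trans (labels v (select M j)) (v-agrees j))

  2^n≤k^k*[1+n]^d : ∀ {d} → (∀ m ys → PsiBShatters H m ys → m ≤ d) → 2 ^ n ≤ k ^ k * suc n ^ d
  2^n≤k^k*[1+n]^d {d} dim = begin
    2 ^ n                  ≤⟨ pigeonhole (k ^ k) code (λ v → toℕ<n (funToFin (rotation v))) class-bound ⟩
    k ^ k * Φ n (suc d)    ≤⟨ *-monoʳ-≤ (k ^ k) (Φ≤[1+n]^d n d) ⟩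
    k ^ k * suc n ^ d      ∎
    where
    open ≤-Reasoning
    class-bound : ∀ c → ∣ (λ v → code v ≡ᵇ c) ∣ ≤ Φ n (suc d)
    class-bound c = sauer-shelah (suc d) _
      (λ M → s≤s ∘ dim (size M) (xs ∘ select M) ∘ colour-class-shattering⇒Ψ_B-shattering c M)

-- From 2 ^ n ≤ K * (1 + n) ^ d to a bound on n

n<2^n : ∀ n → n < 2 ^ n
n<2^n zero    = s≤s z≤n
n<2^n (suc n) = subst (suc n <_) (cong (2 ^ n +_) (sym (+-identityʳ (2 ^ n))))
                      (+-mono-≤-< (m^n>0 2 n) (n<2^n n))

1≤⌈log₂n⌉ : ∀ {n} → 2 ≤ n → 1 ≤ ⌈log₂ n ⌉
1≤⌈log₂n⌉ {n} 2≤n = subst (_≤ ⌈log₂ n ⌉) (⌈log₂2^n⌉≡n 1) (⌈log₂⌉-mono-≤ 2≤n)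

n≤2^⌈log₂n⌉ : ∀ n → n ≤ 2 ^ ⌈log₂ n ⌉
n≤2^⌈log₂n⌉ = <-rec _ bound
  where
  bound : ∀ n → (∀ {m} → m < n → m ≤ 2 ^ ⌈log₂ m ⌉) → n ≤ 2 ^ ⌈log₂ n ⌉
  bound zero          _   = z≤n
  bound (suc zero)    _   = ≤-refl
  bound n@(suc (suc m)) rec = begin
    n                            ≡⟨ ⌊n/2⌋+⌈n/2⌉≡n n ⟨
    ⌊ n /2⌋ + ⌈ n /2⌉            ≤⟨ +-monoˡ-≤ ⌈ n /2⌉ (⌊n/2⌋≤⌈n/2⌉ n) ⟩
    ⌈ n /2⌉ + ⌈ n /2⌉            ≤⟨ +-mono-≤ half half ⟩
    2 ^ (L ∸ 1) + 2 ^ (L ∸ 1)    ≡⟨ cong (2 ^ (L ∸ 1) +_) (+-identityʳ (2 ^ (L ∸ 1))) ⟨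
    2 ^ suc (L ∸ 1)              ≡⟨ cong (2 ^_) (trans (+-comm 1 (L ∸ 1)) (m∸n+n≡m (1≤⌈log₂n⌉ {n} (s≤s (s≤s z≤n))))) ⟩
    2 ^ L                        ∎
    where
    open ≤-Reasoning
    L = ⌈log₂ n ⌉
    half : ⌈ n /2⌉ ≤ 2 ^ (L ∸ 1)
    half = subst (λ e → ⌈ n /2⌉ ≤ 2 ^ e) (⌈log₂⌈n/2⌉⌉≡⌈log₂n⌉∸1 n) (rec (⌈n/2⌉<n m))

[m*n]^o≡m^o*n^o : ∀ m n o → (m * n) ^ o ≡ m ^ o * n ^ o
[m*n]^o≡m^o*n^o m n zero    = refl
[m*n]^o≡m^o*n^o m n (suc o) =
  trans (cong (m * n *_) ([m*n]^o≡m^o*n^o m n o)) (*-interchange m n (m ^ o) (n ^ o))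

2+n+n≡2*[1+n] : ∀ n → suc (suc n + n) ≡ 2 * suc n
2+n+n≡2*[1+n] = solve-∀

module Threshold (K d : ℕ) where

  -- The spare factor 2 ^ d is what survives doubling N, since (2 (1 + N)) ^ d = 2 ^ d (1 + N) ^ d.
  IsThreshold : ℕ → Set
  IsThreshold N = d ≤ N × 2 ^ d * K * suc N ^ d < 2 ^ N

  double : ℕ → ℕ
  double N = suc N + N

  K*[1+n]^d≤2^d*K*[1+N]^d : ∀ {N n} → n ≤ double N → K * suc n ^ d ≤ 2 ^ d * K * suc N ^ d
  K*[1+n]^d≤2^d*K*[1+N]^d {N} {n} n≤ = begin
    K * suc n ^ d                ≤⟨ *-monoʳ-≤ K (^-monoˡ-≤ d (s≤s n≤)) ⟩
    K * suc (double N) ^ d       ≡⟨ cong (λ m → K * m ^ d) (2+n+n≡2*[1+n] N) ⟩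
    K * (2 * suc N) ^ d          ≡⟨ cong (K *_) ([m*n]^o≡m^o*n^o 2 (suc N) d) ⟩
    K * (2 ^ d * suc N ^ d)      ≡⟨ *-assoc K (2 ^ d) (suc N ^ d) ⟨
    K * 2 ^ d * suc N ^ d        ≡⟨ cong (_* suc N ^ d) (*-comm K (2 ^ d)) ⟩
    2 ^ d * K * suc N ^ d        ∎
    where open ≤-Reasoning

  double-threshold : ∀ {N} → IsThreshold N → IsThreshold (double N)
  double-threshold {N} (d≤N , small) = ≤-trans d≤N (m≤n+m N (suc N)) , (begin-strict
    2 ^ d * K * suc (double N) ^ d    ≡⟨ *-assoc (2 ^ d) K (suc (double N) ^ d) ⟩
    2 ^ d * (K * suc (double N) ^ d)  ≤⟨ *-monoʳ-≤ (2 ^ d) (K*[1+n]^d≤2^d*K*[1+N]^d ≤-refl) ⟩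
    2 ^ d * (2 ^ d * K * suc N ^ d)   <⟨ *-monoʳ-< (2 ^ d) {{m^n≢0 2 d}} small ⟩
    2 ^ d * 2 ^ N                     ≤⟨ *-monoˡ-≤ (2 ^ N) (^-monoʳ-≤ 2 (m≤n⇒m≤1+n d≤N)) ⟩
    2 ^ suc N * 2 ^ N                 ≡⟨ ^-distribˡ-+-* 2 (suc N) N ⟨
    2 ^ double N                      ∎)
    where open ≤-Reasoning

  within-double : ∀ {N n} → IsThreshold N → N ≤ n → n ≤ double N → K * suc n ^ d < 2 ^ n
  within-double (_ , small) N≤n n≤2N+1 =
    ≤-<-trans (K*[1+n]^d≤2^d*K*[1+N]^d n≤2N+1) (<-≤-trans small (^-monoʳ-≤ 2 N≤n))

  beyond-threshold : ∀ {N n} → IsThreshold N → N ≤ n → K * suc n ^ d < 2 ^ n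
  beyond-threshold {N} {n} th N≤n = go n th N≤n (m≤m+n n N)
    where
    -- fuel bounds the number of doublings of N still needed to pass n.
    go : ∀ fuel {N} → IsThreshold N → N ≤ n → n ≤ fuel + N → K * suc n ^ d < 2 ^ n
    go fuel {N} th N≤n n≤ with n ≤? double N
    ... | yes n≤2N+1 = within-double th N≤n n≤2N+1
    go zero {N} th N≤n n≤ | no n≰2N+1 = ⊥-elim (n≰2N+1 (≤-trans n≤ (m≤n+m N (suc N))))
    go (suc fuel) {N} th N≤n n≤ | no n≰2N+1 =
      go fuel (double-threshold th) (<⇒≤ (≰⇒> n≰2N+1))
         (≤-trans n≤ (≤-trans (≤-reflexive (sym (+-suc fuel N))) (+-monoʳ-≤ fuel (m≤m+n (suc N) N))))

9kd⌈log₂kd⌉-threshold : ∀ {k d} → 2 ≤ k → 1 ≤ d →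
  Threshold.IsThreshold (k ^ k) d (9 * (k * d * ⌈log₂ (k * d) ⌉))
9kd⌈log₂kd⌉-threshold {k} {d} 2≤k 1≤d = ≤-trans d≤P (m≤n*m P 9) , (begin-strict
  2 ^ d * k ^ k * suc (9 * P) ^ d
    ≤⟨ *-mono-≤ (*-monoʳ-≤ (2 ^ d) k^k≤2^[L*k]) [1+9P]^d≤2^[[4+2L]*d] ⟩
  2 ^ d * 2 ^ (L * k) * 2 ^ ((4 + (L + L)) * d)
    ≡⟨ cong (_* 2 ^ ((4 + (L + L)) * d)) (^-distribˡ-+-* 2 d (L * k)) ⟨
  2 ^ (d + L * k) * 2 ^ ((4 + (L + L)) * d)
    ≡⟨ ^-distribˡ-+-* 2 (d + L * k) ((4 + (L + L)) * d) ⟨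
  2 ^ (d + L * k + (4 + (L + L)) * d)
    ≤⟨ ^-monoʳ-≤ 2 exponent≤8P ⟩
  2 ^ (8 * P)
    <⟨ ^-monoʳ-< 2 (s≤s (s≤s z≤n)) (+-monoˡ-≤ (8 * P) 1≤P) ⟩
  2 ^ (9 * P) ∎)
  where
  open ≤-Reasoning
  L = ⌈log₂ (k * d) ⌉
  P = k * d * L

  1≤k : 1 ≤ k
  1≤k = ≤-trans (n≤1+n 1) 2≤k
  1≤L : 1 ≤ L
  1≤L = 1≤⌈log₂n⌉ (*-mono-≤ 2≤k 1≤d)
  1≤P : 1 ≤ P
  1≤P = *-mono-≤ (*-mono-≤ 1≤k 1≤d) 1≤L
  kd≤2^L : k * d ≤ 2 ^ L
  kd≤2^L = n≤2^⌈log₂n⌉ (k * d)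

  d≤kd : d ≤ k * d
  d≤kd = m≤n*m d k {{>-nonZero 1≤k}}
  k≤kd : k ≤ k * d
  k≤kd = m≤m*n k d {{>-nonZero 1≤d}}
  d≤P : d ≤ P
  d≤P = ≤-trans d≤kd (m≤m*n (k * d) L {{>-nonZero 1≤L}})
  L*k≤P : L * k ≤ P
  L*k≤P = subst (_≤ P) (*-comm k L) (*-monoˡ-≤ L k≤kd)
  L*d≤P : L * d ≤ P
  L*d≤P = subst (_≤ P) (*-comm d L) (*-monoˡ-≤ L d≤kd)

  exponent≤8P : d + L * k + (4 + (L + L)) * d ≤ 8 * P
  exponent≤8P = begin
    d + L * k + (4 + (L + L)) * d   ≡⟨ regroup d L k ⟩
    5 * d + L * k + 2 * (L * d)     ≤⟨ +-mono-≤ (+-mono-≤ (*-monoʳ-≤ 5 d≤P) L*k≤P) (*-monoʳ-≤ 2 L*d≤P) ⟩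
    5 * P + P + 2 * P               ≡⟨ collect P ⟩
    8 * P                           ∎
    where
    regroup : ∀ d L k → d + L * k + (4 + (L + L)) * d ≡ 5 * d + L * k + 2 * (L * d)
    regroup = solve-∀
    collect : ∀ P → 5 * P + P + 2 * P ≡ 8 * P
    collect = solve-∀

  k^k≤2^[L*k] : k ^ k ≤ 2 ^ (L * k)
  k^k≤2^[L*k] = begin
    k ^ k          ≤⟨ ^-monoˡ-≤ k (≤-trans k≤kd kd≤2^L) ⟩
    (2 ^ L) ^ k    ≡⟨ ^-*-assoc 2 L k ⟩
    2 ^ (L * k)    ∎

  [1+9P]^d≤2^[[4+2L]*d] : suc (9 * P) ^ d ≤ 2 ^ ((4 + (L + L)) * d)
  [1+9P]^d≤2^[[4+2L]*d] = begin
    suc (9 * P) ^ d             ≤⟨ ^-monoˡ-≤ d 1+9P≤2^[4+2L] ⟩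
    (2 ^ (4 + (L + L))) ^ d     ≡⟨ ^-*-assoc 2 (4 + (L + L)) d ⟩
    2 ^ ((4 + (L + L)) * d)     ∎
    where
    1+9P≤2^[4+2L] : suc (9 * P) ≤ 2 ^ (4 + (L + L))
    1+9P≤2^[4+2L] = begin
      suc (9 * P)              ≤⟨ +-monoˡ-≤ (9 * P) 1≤P ⟩
      10 * P                   ≤⟨ *-monoˡ-≤ P (m≤m+n 10 6) ⟩
      16 * P                   ≤⟨ *-monoʳ-≤ 16 (*-mono-≤ kd≤2^L (<⇒≤ (n<2^n L))) ⟩
      16 * (2 ^ L * 2 ^ L)     ≡⟨ cong (16 *_) (^-distribˡ-+-* 2 L L) ⟨
      16 * 2 ^ (L + L)         ≡⟨ ^-distribˡ-+-* 2 4 (L + L) ⟨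
      2 ^ (4 + (L + L))        ∎

2^n≤k^k*[1+n]^d⇒n≤9kd⌈log₂kd⌉ : ∀ {k d n} → 2 ≤ k → 1 ≤ d →
  2 ^ n ≤ k ^ k * suc n ^ d → n ≤ 9 * (k * d * ⌈log₂ (k * d) ⌉)
2^n≤k^k*[1+n]^d⇒n≤9kd⌈log₂kd⌉ {k} {d} 2≤k 1≤d 2^n≤ = ≮⇒≥ λ 9P<n →
  <⇒≱ (Threshold.beyond-threshold (k ^ k) d (9kd⌈log₂kd⌉-threshold 2≤k 1≤d) (<⇒≤ 9P<n)) 2^n≤

lemma4p6 : Σ ℕ λ C →
    {I : Set} (k : ℕ) (H : Class I k) (d : ℕ) →
    IsPsiBDim H d → 1 ≤ d →
    (n : ℕ) (xs : Fin n → I) → PsiBShatters (rc H) n xs →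
    n ≤ C * (k * d * ⌈log₂ (k * d) ⌉)
lemma4p6 = 9 , bound
  where
  bound : {I : Set} (k : ℕ) (H : Class I k) (d : ℕ) → IsPsiBDim H d → 1 ≤ d →
    (n : ℕ) (xs : Fin n → I) → PsiBShatters (rc H) n xs → n ≤ 9 * (k * d * ⌈log₂ (k * d) ⌉)
  bound k H d dim 1≤d zero    xs shattered = z≤n
  bound k H d dim 1≤d (suc n) xs shattered =
    2^n≤k^k*[1+n]^d⇒n≤9kd⌈log₂kd⌉ (shattering-needs-two-labels shattered) 1≤d
      (RotationalCompletion.2^n≤k^k*[1+n]^d shattered (proj₂ dim))
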